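{- Let $f:2^U\to\mathbb{R}_{\ge0}$ be monotone submodular, $U$ partitioned into $U_1,\dots,U_N$, and $k_1,\dots,k_N$ positive integers with $k_j\le|U_j|$ and $\gcd(k_1,\dots,k_N)=c$. Let $\mathcal{P}=\{S\subseteq U:|S\cap U_i|\le k_i\ \forall i\in[N]\}$. Run Block-Greedy with subroutine Greedy-Subroutine-Mono (described in the context) with $\phi=c$ and $r_j=k_j/c$ for each $j\in[N]$. Then its output $S$ satisfies $f(S)\ge(1-1/e-1/c)f(OPT)$, where $OPT\in\arg\max_{S\in\mathcal{P}}f(S)$.
   Context: $f$ submodular: $f(A\cup\{x\})-f(A)\ge f(B\cup\{x\})-f(B)$ for $A\subseteq B\subseteq U$, $x\notin B$; monotone: $f(X)\le f(Y)$ for $X\subseteq Y$; $\Delta f(S,x)=f(S\cup\{x\})-f(S)$. Block-Greedy with Greedy-Subroutine-Mono and parameters $\phi,r_1,\dots,r_N$: $S\gets\emptyset$; for $i=1,\dots,\phi$: for $j=1,\dots,N$: repeat $r_j$ times: $S\gets S\cup\{\arg\max_{x\in U_j}\Delta f(S,x)\}$. Return $S$. -}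

module Defs where

open import Level using (Level; _⊔_) renaming (suc to lsuc)
open import Data.Nat as ℕ using (ℕ; zero; suc)
open import Data.Nat.GCD using (gcd)
open import Data.Fin using (Fin)
open import Data.Fin.Subset using (Subset; _∪_; _∩_; ⁅_⁆; ∣_∣; _⊆_; _∉_; inside; outside)
open import Data.Vec using (tabulate)
open import Data.List using (List; []; _∷_; concat; concatMap; replicate; foldr; map; allFin)
open import Relation.Binary using (Rel; IsTotalOrder)
open import Relation.Binary.PropositionalEquality using (_≡_)
open import Relation.Nullary.Decidable using (⌊_⌋)
open import Algebra.Bundles using (CommutativeRing)
import Data.Fin as F

-- A (totally) ordered commutative ring.  The real numbers are an instance;
-- stating the theorem for every such ring generalises the real-valued case.
record OrderedCommRing (c ℓ₁ ℓ₂ : Level) : Set (lsuc (c ⊔ ℓ₁ ⊔ ℓ₂)) where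
  field
    commutativeRing : CommutativeRing c ℓ₁
  open CommutativeRing commutativeRing public
  infix 4 _≤_
  field
    _≤_          : Rel Carrier ℓ₂
    isTotalOrder : IsTotalOrder _≈_ _≤_
    +-mono-≤     : ∀ {x y} z → x ≤ y → x + z ≤ y + z
    *-nonneg     : ∀ {x y} → 0# ≤ x → 0# ≤ y → 0# ≤ x * y

  ι : ℕ → Carrier
  ι zero    = 0#
  ι (suc n) = 1# + ι n

module SetFunctions {c ℓ₁ ℓ₂} (R : OrderedCommRing c ℓ₁ ℓ₂) {n : ℕ} where
  open OrderedCommRing R

  Δ : (Subset n → Carrier) → Subset n → Fin n → Carrier
  Δ f S x = f (S ∪ ⁅ x ⁆) - f S

  Monotone : (Subset n → Carrier) → Set _
  Monotone f = ∀ X Y → X ⊆ Y → f X ≤ f Y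

  Submodular : (Subset n → Carrier) → Set _
  Submodular f = ∀ A B x → A ⊆ B → x ∉ B → Δ f B x ≤ Δ f A x

  NonNegative : (Subset n → Carrier) → Set _
  NonNegative f = ∀ S → 0# ≤ f S

module Partition {n N : ℕ} (block : Fin n → Fin N) where
  blockSet : Fin N → Subset n
  blockSet j = tabulate (λ x → ⌊ block x F.≟ j ⌋)

  InP : (Fin N → ℕ) → Subset n → Set
  InP k S = ∀ i → ∣ S ∩ blockSet i ∣ ℕ.≤ k i

gcdAll : ∀ {N} → (Fin N → ℕ) → ℕ
gcdAll {N} k = foldr gcd 0 (map k (allFin N))

-- Order in which Block-Greedy processes blocks:
-- φ outer rounds, each round visits j = 1..N and picks r_j elements from U_j.
schedule : ∀ {N} → ℕ → (Fin N → ℕ) → List (Fin N)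
schedule {N} φ r = concat (replicate φ (concatMap (λ j → replicate (r j) j) (allFin N)))

-- Run js S T means:
-- starting from current set S and processing the block sequence js, the
-- algorithm can end with T, where each step adds an arg max over U_j of
-- Δ f(S,·) (any tie-breaking).
module Greedy {c ℓ₁ ℓ₂} (R : OrderedCommRing c ℓ₁ ℓ₂) {n N : ℕ}
              (block : Fin n → Fin N) (f : Subset n → OrderedCommRing.Carrier R) where
  open OrderedCommRing R
  open SetFunctions R {n}

  data Run : List (Fin N) → Subset n → Subset n → Set (c ⊔ ℓ₁ ⊔ ℓ₂) where
    done : ∀ {S} → Run [] S S
    step : ∀ {j js S T} (x : Fin n) → block x ≡ j →
           (∀ y → block y ≡ j → Δ f S y ≤ Δ f S x) →
           Run js (S ∪ ⁅ x ⁆) T → Run (j ∷ js) S T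

-- Rational-arithmetic form of  fS ≥ (1 - (m/(m+1))^m - 1/c) · fOPT,
-- multiplied through by the positive number c·(m+1)^m.
-- Since (m/(m+1))^m = (1-1/(m+1))^m decreases to 1/e, holding this for all m
-- is equivalent (for fOPT ≥ 0 in ℝ) to  fS ≥ (1 - 1/e - 1/c) · fOPT.
module _ {a ℓ₁ ℓ₂} (R : OrderedCommRing a ℓ₁ ℓ₂) where
  open OrderedCommRing R
  open import Data.Nat using (_^_) renaming (_*_ to _*ℕ_; _+_ to _+ℕ_)

  ApproxBound : ℕ → ℕ → Carrier → Carrier → Set ℓ₂
  ApproxBound c m fS fOPT =
    ι (c *ℕ suc m ^ m) * fOPT ≤ ι (c *ℕ suc m ^ m) * fS + ι (c *ℕ m ^ m +ℕ suc m ^ m) * fOPT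

{-# OPTIONS --safe #-}
module Submission where

-- Fix a round of the algorithm (every block j visited for r_j greedy steps), starting at S and
-- ending at S'.  A greedy step in U_j from A ⊆ S' gains at least Δf(A, y) ≥ Δf(S', y) for every
-- y ∈ U_j; over the r_j steps of block j and the at most c·r_j elements of OPT ∩ U_j this gives
-- Σ_{y ∈ OPT ∩ U_j} Δf(S', y) ≤ c·(gain of block j).  Summing over the blocks and using
-- f(OPT) − f(S') ≤ f(S' ∪ OPT) − f(S') ≤ Σ_{y ∈ OPT} Δf(S', y) yields
-- (c+1)(f(OPT) − f(S')) ≤ c (f(OPT) − f(S)), so after c rounds
-- (c+1)^c (f(OPT) − f(S)) ≤ c^c f(OPT).  It remains that (c/(c+1))^c ≤ (m/(m+1))^m + 1/c for
-- every m, because (x/(x+1))^(x+1) increases and (x/(x+1))^x decreases (Bernoulli's inequality).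
-- No division is available in an ordered ring, so ratios are compared cross-multiplied.

open import Defs
open import Data.Nat as ℕ using (ℕ; zero; suc; NonZero)
import Data.Nat.Properties as ℕ
open import Data.Bool.Properties using (T-≡)
open import Data.Fin as Fin using (Fin)
open import Data.Fin.Subset using (Subset; ⊥; _∪_; _∩_; ⁅_⁆; ∣_∣; _⊆_; _∈_; inside; outside)
open import Data.Fin.Subset.Properties
  using (_∈?_; p⊆p∪q; x∈p∪q⁻; x∈p∪q⁺; x∈⁅x⁆; x∈⁅y⁆⇒x≡y; ⊆-refl; ⊆-trans; x∈p∩q⁺; x∈p∩q⁻)
open import Data.List
  using (List; []; _∷_; _++_; map; foldr; replicate; concat; concatMap; allFin; length)
open import Data.List.Properties using (length-map)
open import Data.List.Membership.Propositional using (lose) renaming (_∈_ to _∈ₗ_)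
open import Data.List.Membership.Propositional.Properties using (∈-map⁺; ∈-map⁻; ∈-allFin; ∈-concatMap⁺)
open import Data.List.Relation.Unary.Any using (here; there)
open import Data.Product using (∃-syntax; _×_; _,_; proj₂)
open import Data.Sum using (inj₁; inj₂)
open import Data.Vec using ([]; _∷_; here; there)
open import Data.Vec.Properties using (lookup∘tabulate; []=⇒lookup; lookup⇒[]=)
open import Function using (Equivalence; _∘_)
open import Relation.Binary.Bundles using (Poset)
open import Relation.Binary.Structures using (IsTotalOrder)
open import Relation.Binary.PropositionalEquality as ≡ using (_≡_)
import Relation.Binary.Reasoning.PartialOrder as PosetReasoning
open import Relation.Nullary using (yes; no)
open import Relation.Nullary.Decidable using (toWitness; fromWitness)

module BernoulliEstimates where
  open import Data.Nat hiding (_/_)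
  open import Data.Nat.Properties
  open import Data.Nat.Solver using (module +-*-Solver)
  open import Relation.Binary.PropositionalEquality
  open import Algebra.Properties.CommutativeSemigroup *-commutativeSemigroup
    using (interchange; x∙yz≈y∙xz; xy∙z≈xz∙y; xy∙z≈x∙zy)
  open +-*-Solver

  infix 4 _/_≤_/_

  record _/_≤_/_ (p q r s : ℕ) : Set where
    constructor *≤*
    field cross-≤ : p * s ≤ r * q

  open _/_≤_/_

  /-≤-trans : ∀ {p q r s t u} .{{_ : NonZero s}} → p / q ≤ r / s → r / s ≤ t / u → p / q ≤ t / u
  /-≤-trans {p} {q} {r} {s} {t} {u} (*≤* pq≤rs) (*≤* rs≤tu) = *≤* (*-cancelʳ-≤ (p * u) (t * q) s (begin
    p * u * s   ≡⟨ xy∙z≈xz∙y p u s ⟩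
    p * s * u   ≤⟨ *-monoˡ-≤ u pq≤rs ⟩
    r * q * u   ≡⟨ xy∙z≈xz∙y r q u ⟩
    r * u * q   ≤⟨ *-monoˡ-≤ q rs≤tu ⟩
    t * s * q   ≡⟨ xy∙z≈xz∙y t s q ⟩
    t * q * s   ∎))
    where open ≤-Reasoning

  /-≤-reciprocal : ∀ {p q r s} → p / q ≤ r / s → s / r ≤ q / p
  /-≤-reciprocal {p} {q} {r} {s} (*≤* pq≤rs) = *≤* (subst₂ _≤_ (*-comm p s) (*-comm r q) pq≤rs)

  /-≤-increasing : (num den : ℕ → ℕ) → (∀ x → NonZero (den x)) →
                   (∀ x → num x / den x ≤ num (suc x) / den (suc x)) →
                   ∀ {x y} → x ≤ y → num x / den x ≤ num y / den y
  /-≤-increasing num den den≢0 step x≤y = go (≤⇒≤′ x≤y)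
    where
    go : ∀ {x y} → x ≤′ y → num x / den x ≤ num y / den y
    go ≤′-refl = *≤* ≤-refl
    go (≤′-step {y} x≤′y) = /-≤-trans {{den≢0 y}} (go x≤′y) (step y)

  ^-distribʳ-* : ∀ m n o → (m * n) ^ o ≡ m ^ o * n ^ o
  ^-distribʳ-* m n zero    = refl
  ^-distribʳ-* m n (suc o) =
    trans (cong (m * n *_) (^-distribʳ-* m n o)) (interchange m n (m ^ o) (n ^ o))

  bernoulli : ∀ p n → p ^ n * (n + p) ≤ p * suc p ^ n
  bernoulli p zero    = ≤-reflexive (*-comm 1 p)
  bernoulli p (suc n) = begin
    p * p ^ n * suc (n + p)
      ≤⟨ m≤m+n _ (p ^ n * n) ⟩
    p * p ^ n * suc (n + p) + p ^ n * n
      ≡⟨ solve 3 (λ p n P → p :* P :* (con 1 :+ n :+ p) :+ P :* n := P :* (n :+ p) :* (con 1 :+ p))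
               refl p n (p ^ n) ⟩
    p ^ n * (n + p) * suc p
      ≤⟨ *-monoˡ-≤ (suc p) (bernoulli p n) ⟩
    p * suc p ^ n * suc p
      ≡⟨ xy∙z≈x∙zy p (suc p ^ n) (suc p) ⟩
    p * (suc p * suc p ^ n) ∎
    where open ≤-Reasoning

  bernoulli⁻ : ∀ u n → suc u ^ suc n ≤ suc u * u ^ n + n * suc u ^ n
  bernoulli⁻ u zero    = ≤-reflexive (sym (+-identityʳ _))
  bernoulli⁻ u (suc n) = begin
    s * (s * s ^ n)
      ≤⟨ *-monoʳ-≤ s (bernoulli⁻ u n) ⟩
    s * (s * u ^ n + n * s ^ n)
      ≡⟨ solve 4 (λ u U n S → (con 1 :+ u) :* ((con 1 :+ u) :* U :+ n :* S)
                            := (con 1 :+ u) :* (u :* U) :+ (con 1 :+ u) :* U :+ n :* ((con 1 :+ u) :* S))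
               refl u (u ^ n) n (s ^ n) ⟩
    s * (u * u ^ n) + s * u ^ n + n * (s * s ^ n)
      ≤⟨ +-monoˡ-≤ (n * (s * s ^ n)) (+-monoʳ-≤ (s * (u * u ^ n)) (*-monoʳ-≤ s (^-monoˡ-≤ n (n≤1+n u)))) ⟩
    s * (u * u ^ n) + s * s ^ n + n * (s * s ^ n)
      ≡⟨ +-assoc (s * (u * u ^ n)) (s * s ^ n) (n * (s * s ^ n)) ⟩
    s * (u * u ^ n) + suc n * (s * s ^ n) ∎
    where
    s = suc u
    open ≤-Reasoning

  1+x[2+x]≡[1+x][1+x] : ∀ x → suc (x * suc (suc x)) ≡ suc x * suc x
  1+x[2+x]≡[1+x][1+x] = solve 1 (λ x → con 1 :+ x :* (con 2 :+ x) := (con 1 :+ x) :* (con 1 :+ x)) refl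

  -- Both steps apply Bernoulli at p = x(x+2), for which p + 1 = (x+1)².
  1/e-below-step : ∀ x → x ^ suc x / suc x ^ suc x ≤ suc x ^ suc (suc x) / suc (suc x) ^ suc (suc x)
  1/e-below-step x = *≤* (subst₂ _≤_ lhs rhs (cross-≤ (/-≤-trans bern side)))
    where
    s = suc x
    t = suc s
    p = x * t
    bern : p ^ s / suc p ^ s ≤ p / (s + p)
    bern = *≤* (bernoulli p s)
    side : p / (s + p) ≤ s / t
    side = *≤* (≤-trans (n≤1+n _) (≤-reflexive (solve 1 (λ x →
      con 1 :+ x :* (con 2 :+ x) :* (con 2 :+ x)
        := (con 1 :+ x) :* (con 1 :+ x :+ x :* (con 2 :+ x))) refl x)))
    lhs : p ^ s * t ≡ x ^ s * t ^ t
    lhs = begin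
      p ^ s * t              ≡⟨ cong (_* t) (^-distribʳ-* x t s) ⟩
      x ^ s * t ^ s * t      ≡⟨ *-assoc (x ^ s) (t ^ s) t ⟩
      x ^ s * (t ^ s * t)    ≡⟨ cong (x ^ s *_) (*-comm (t ^ s) t) ⟩
      x ^ s * t ^ t          ∎
      where open ≡-Reasoning
    rhs : s * suc p ^ s ≡ s ^ t * s ^ s
    rhs = begin
      s * suc p ^ s          ≡⟨ cong (λ y → s * y ^ s) (1+x[2+x]≡[1+x][1+x] x) ⟩
      s * (s * s) ^ s        ≡⟨ cong (s *_) (^-distribʳ-* s s s) ⟩
      s * (s ^ s * s ^ s)    ≡⟨ *-assoc s (s ^ s) (s ^ s) ⟨
      s ^ t * s ^ s          ∎
      where open ≡-Reasoning

  e-below-step : ∀ x → suc x ^ x / x ^ x ≤ suc (suc x) ^ suc x / suc x ^ suc x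
  e-below-step x = *≤* (subst₂ _≤_ lhs rhs (cross-≤ (/-≤-trans bern side)))
    where
    s = suc x
    t = suc s
    p = x * t
    K = suc (x * s)
    bern : suc p ^ x / p ^ x ≤ suc p / K
    bern = *≤* (+-cancelʳ-≤ (x * suc p ^ x) _ _ (begin
      suc p ^ x * K + x * suc p ^ x
        ≡⟨ solve 2 (λ x Q → Q :* (con 1 :+ x :* (con 1 :+ x)) :+ x :* Q
                          := (con 1 :+ x :* (con 2 :+ x)) :* Q) refl x (suc p ^ x) ⟩
      suc p ^ s                       ≤⟨ bernoulli⁻ p x ⟩
      suc p * p ^ x + x * suc p ^ x   ∎))
      where open ≤-Reasoning
    side : suc p / K ≤ t / s
    side = *≤* (≤-trans (n≤1+n _) (≤-reflexive (solve 1 (λ x →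
      con 1 :+ (con 1 :+ x :* (con 2 :+ x)) :* (con 1 :+ x)
        := (con 2 :+ x) :* (con 1 :+ x :* (con 1 :+ x))) refl x)))
    lhs : suc p ^ x * s ≡ s ^ x * s ^ s
    lhs = begin
      suc p ^ x * s          ≡⟨ cong (λ y → y ^ x * s) (1+x[2+x]≡[1+x][1+x] x) ⟩
      (s * s) ^ x * s        ≡⟨ cong (_* s) (^-distribʳ-* s s x) ⟩
      s ^ x * s ^ x * s      ≡⟨ *-assoc (s ^ x) (s ^ x) s ⟩
      s ^ x * (s ^ x * s)    ≡⟨ cong (s ^ x *_) (*-comm (s ^ x) s) ⟩
      s ^ x * s ^ s          ∎
      where open ≡-Reasoning
    rhs : t * p ^ x ≡ t ^ s * x ^ x
    rhs = begin
      t * p ^ x              ≡⟨ cong (t *_) (^-distribʳ-* x t x) ⟩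
      t * (x ^ x * t ^ x)    ≡⟨ cong (t *_) (*-comm (x ^ x) (t ^ x)) ⟩
      t * (t ^ x * x ^ x)    ≡⟨ *-assoc t (t ^ x) (x ^ x) ⟨
      t ^ s * x ^ x          ∎
      where open ≡-Reasoning

  x^x≢0 : ∀ x → NonZero (x ^ x)
  x^x≢0 zero    = _
  x^x≢0 (suc x) = m^n≢0 (suc x) (suc x)

  [x/[1+x]]^[1+x]≤[x/[1+x]]^x : ∀ x → x ^ suc x / suc x ^ suc x ≤ x ^ x / suc x ^ x
  [x/[1+x]]^[1+x]≤[x/[1+x]]^x x = *≤* (begin
    x * x ^ x * suc x ^ x         ≤⟨ *-monoˡ-≤ (suc x ^ x) (*-monoˡ-≤ (x ^ x) (n≤1+n x)) ⟩
    suc x * x ^ x * suc x ^ x     ≡⟨ *-assoc (suc x) (x ^ x) (suc x ^ x) ⟩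
    suc x * (x ^ x * suc x ^ x)   ≡⟨ x∙yz≈y∙xz (suc x) (x ^ x) (suc x ^ x) ⟩
    x ^ x * (suc x * suc x ^ x)   ∎)
    where open ≤-Reasoning

  1/e-below≤1/e-above : ∀ c m → c ^ suc c / suc c ^ suc c ≤ m ^ m / suc m ^ m
  1/e-below≤1/e-above c m with ≤-total c m
  ... | inj₁ c≤m = /-≤-trans {{m^n≢0 (suc m) (suc m)}}
    (/-≤-increasing (λ x → x ^ suc x) (λ x → suc x ^ suc x) (λ x → m^n≢0 (suc x) (suc x))
                    1/e-below-step c≤m)
    ([x/[1+x]]^[1+x]≤[x/[1+x]]^x m)
  ... | inj₂ m≤c = /-≤-trans {{m^n≢0 (suc c) c}}
    ([x/[1+x]]^[1+x]≤[x/[1+x]]^x c)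
    (/-≤-reciprocal (/-≤-increasing (λ x → suc x ^ x) (λ x → x ^ x) x^x≢0 e-below-step m≤c))

  ratio-bound : ∀ c m → c ^ c / suc c ^ c ≤ (c * m ^ m + suc m ^ m) / (c * suc m ^ m)
  ratio-bound c m = *≤* (begin
    c ^ c * (c * suc m ^ m)        ≡⟨ x∙yz≈y∙xz (c ^ c) c (suc m ^ m) ⟩
    c * (c ^ c * suc m ^ m)        ≡⟨ *-assoc c (c ^ c) (suc m ^ m) ⟨
    c ^ suc c * suc m ^ m          ≤⟨ cross-≤ (1/e-below≤1/e-above c m) ⟩
    m ^ m * suc c ^ suc c
      ≡⟨ solve 3 (λ M c C → M :* ((con 1 :+ c) :* C) := (c :* M :+ M) :* C) refl (m ^ m) c (suc c ^ c) ⟩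
    (c * m ^ m + m ^ m) * suc c ^ c
      ≤⟨ *-monoˡ-≤ (suc c ^ c) (+-monoʳ-≤ (c * m ^ m) (^-monoˡ-≤ m (n≤1+n m))) ⟩
    (c * m ^ m + suc m ^ m) * suc c ^ c ∎)
    where open ≤-Reasoning

open BernoulliEstimates using (_/_≤_/_; *≤*; ratio-bound)

module OrderedCommRingProperties {a ℓ₁ ℓ₂} (R : OrderedCommRing a ℓ₁ ℓ₂) where
  open OrderedCommRing R hiding (+-mono-≤)
  open OrderedCommRing R public using () renaming (+-mono-≤ to +-monoˡ-≤)
  open IsTotalOrder isTotalOrder public
    using (total) renaming (refl to ≤-refl; trans to ≤-trans; reflexive to ≤-reflexive)
  open import Algebra.Properties.Ring ring using (x[y-z]≈xy-xz; -‿distribˡ-*; -‿involutive)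
  open import Algebra.Properties.Group +-group using (//-rightDividesˡ; //-rightDividesʳ)
  open import Algebra.Properties.CommutativeSemigroup *-commutativeSemigroup using (x∙yz≈y∙xz)

  ≤-poset : Poset a ℓ₁ ℓ₂
  ≤-poset = record { isPartialOrder = IsTotalOrder.isPartialOrder isTotalOrder }

  module ≤-Reasoning = PosetReasoning ≤-poset
  open ≤-Reasoning

  +-monoʳ-≤ : ∀ z {x y} → x ≤ y → z + x ≤ z + y
  +-monoʳ-≤ z {x} {y} x≤y = begin
    z + x  ≈⟨ +-comm z x ⟩
    x + z  ≤⟨ +-monoˡ-≤ z x≤y ⟩
    y + z  ≈⟨ +-comm y z ⟩
    z + y  ∎

  +-mono-≤ : ∀ {x y u v} → x ≤ y → u ≤ v → x + u ≤ y + v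
  +-mono-≤ {y = y} {u} x≤y u≤v = ≤-trans (+-monoˡ-≤ u x≤y) (+-monoʳ-≤ y u≤v)

  +-cancelʳ-≤ : ∀ z {x y} → x + z ≤ y + z → x ≤ y
  +-cancelʳ-≤ z {x} {y} x+z≤y+z = begin
    x            ≈⟨ //-rightDividesʳ z x ⟨
    x + z - z    ≤⟨ +-monoˡ-≤ (- z) x+z≤y+z ⟩
    y + z - z    ≈⟨ //-rightDividesʳ z y ⟩
    y            ∎

  x≤y⇒0≤y-x : ∀ {x y} → x ≤ y → 0# ≤ y - x
  x≤y⇒0≤y-x {x} {y} x≤y = begin
    0#      ≈⟨ -‿inverseʳ x ⟨
    x - x   ≤⟨ +-monoˡ-≤ (- x) x≤y ⟩
    y - x   ∎

  0≤y-x⇒x≤y : ∀ {x y} → 0# ≤ y - x → x ≤ y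
  0≤y-x⇒x≤y {x} {y} 0≤y-x = begin
    x            ≈⟨ +-identityˡ x ⟨
    0# + x       ≤⟨ +-monoˡ-≤ x 0≤y-x ⟩
    y - x + x    ≈⟨ //-rightDividesˡ x y ⟩
    y            ∎

  x-y≤z⇒x≤y+z : ∀ {x y z} → x - y ≤ z → x ≤ y + z
  x-y≤z⇒x≤y+z {x} {y} {z} x-y≤z = begin
    x            ≈⟨ //-rightDividesˡ y x ⟨
    x - y + y    ≤⟨ +-monoˡ-≤ y x-y≤z ⟩
    z + y        ≈⟨ +-comm z y ⟩
    y + z        ∎

  0≤y⇒x-y≤x : ∀ {x y} → 0# ≤ y → x - y ≤ x
  0≤y⇒x-y≤x {x} {y} 0≤y = +-cancelʳ-≤ y (begin
    x - y + y    ≈⟨ //-rightDividesˡ y x ⟩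
    x            ≈⟨ +-identityʳ x ⟨
    x + 0#       ≤⟨ +-monoʳ-≤ x 0≤y ⟩
    x + y        ∎)

  [y-x]+[z-y]≈z-x : ∀ x y z → (y - x) + (z - y) ≈ z - x
  [y-x]+[z-y]≈z-x x y z = begin-equality
    (y - x) + (z - y)    ≈⟨ +-comm (y - x) (z - y) ⟩
    (z - y) + (y - x)    ≈⟨ +-assoc (z - y) y (- x) ⟨
    (z - y + y) - x      ≈⟨ +-congʳ (//-rightDividesˡ y z) ⟩
    z - x                ∎

  *-monoˡ-≤-nonNeg : ∀ {z x y} → 0# ≤ z → x ≤ y → z * x ≤ z * y
  *-monoˡ-≤-nonNeg {z} {x} {y} 0≤z x≤y = 0≤y-x⇒x≤y (begin
    0#               ≤⟨ *-nonneg 0≤z (x≤y⇒0≤y-x x≤y) ⟩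
    z * (y - x)      ≈⟨ x[y-z]≈xy-xz z y x ⟩
    z * y - z * x    ∎)

  0≤1 : 0# ≤ 1#
  0≤1 with total 0# 1#
  ... | inj₁ 0≤1 = 0≤1
  ... | inj₂ 1≤0 = begin
    0#             ≤⟨ *-nonneg 0≤-1 0≤-1 ⟩
    - 1# * - 1#    ≈⟨ -‿distribˡ-* 1# (- 1#) ⟨
    - (1# * - 1#)  ≈⟨ -‿cong (*-identityˡ (- 1#)) ⟩
    - - 1#         ≈⟨ -‿involutive 1# ⟩
    1#             ∎
    where
    0≤-1 : 0# ≤ - 1#
    0≤-1 = begin
      0#         ≈⟨ -‿inverseʳ 1# ⟨
      1# - 1#    ≤⟨ +-monoˡ-≤ (- 1#) 1≤0 ⟩
      0# - 1#    ≈⟨ +-identityˡ (- 1#) ⟩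
      - 1#       ∎

  0≤ι : ∀ n → 0# ≤ ι n
  0≤ι zero    = ≤-refl
  0≤ι (suc n) = begin
    0#         ≈⟨ +-identityʳ 0# ⟨
    0# + 0#    ≤⟨ +-mono-≤ 0≤1 (0≤ι n) ⟩
    1# + ι n   ∎

  ι-homo-+ : ∀ m n → ι (m ℕ.+ n) ≈ ι m + ι n
  ι-homo-+ zero    n = sym (+-identityˡ (ι n))
  ι-homo-+ (suc m) n = trans (+-congˡ (ι-homo-+ m n)) (sym (+-assoc 1# (ι m) (ι n)))

  ι-suc-* : ∀ n x → ι (suc n) * x ≈ x + ι n * x
  ι-suc-* n x = trans (distribʳ x 1# (ι n)) (+-congʳ (*-identityˡ x))

  ι-homo-* : ∀ m n → ι (m ℕ.* n) ≈ ι m * ι n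
  ι-homo-* zero    n = sym (zeroˡ (ι n))
  ι-homo-* (suc m) n = begin-equality
    ι (n ℕ.+ m ℕ.* n)     ≈⟨ ι-homo-+ n (m ℕ.* n) ⟩
    ι n + ι (m ℕ.* n)     ≈⟨ +-congˡ (ι-homo-* m n) ⟩
    ι n + ι m * ι n       ≈⟨ ι-suc-* m (ι n) ⟨
    ι (suc m) * ι n       ∎

  ι-*-assoc : ∀ m n x → ι (m ℕ.* n) * x ≈ ι m * (ι n * x)
  ι-*-assoc m n x = trans (*-congʳ (ι-homo-* m n)) (*-assoc (ι m) (ι n) x)

  ι-monoˡ-≤ : ∀ {m n x} → m ℕ.≤ n → 0# ≤ x → ι m * x ≤ ι n * x
  ι-monoˡ-≤ {m} {n} {x} m≤n 0≤x = begin
    ι m * x                          ≈⟨ +-identityʳ (ι m * x) ⟨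
    ι m * x + 0#                     ≤⟨ +-monoʳ-≤ (ι m * x) (*-nonneg (0≤ι (n ℕ.∸ m)) 0≤x) ⟩
    ι m * x + ι (n ℕ.∸ m) * x        ≈⟨ distribʳ x (ι m) (ι (n ℕ.∸ m)) ⟨
    (ι m + ι (n ℕ.∸ m)) * x          ≈⟨ *-congʳ (ι-homo-+ m (n ℕ.∸ m)) ⟨
    ι (m ℕ.+ (n ℕ.∸ m)) * x          ≡⟨ ≡.cong (λ k → ι k * x) (ℕ.m+[n∸m]≡n m≤n) ⟩
    ι n * x                          ∎

  ι-*-cancelˡ-≤ : ∀ n .{{_ : NonZero n}} {x y} → ι n * x ≤ ι n * y → x ≤ y
  ι-*-cancelˡ-≤ (suc n) {x} {y} [1+n]x≤[1+n]y with total x y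
  ... | inj₁ x≤y = x≤y
  ... | inj₂ y≤x = +-cancelʳ-≤ (ι n * x) (begin
    x + ι n * x        ≈⟨ ι-suc-* n x ⟨
    ι (suc n) * x      ≤⟨ [1+n]x≤[1+n]y ⟩
    ι (suc n) * y      ≈⟨ ι-suc-* n y ⟩
    y + ι n * y        ≤⟨ +-monoʳ-≤ y (*-monoˡ-≤-nonNeg (0≤ι n) y≤x) ⟩
    y + ι n * x        ∎)

  ι-ratio-weaken : ∀ p {q a b x y} .{{_ : NonZero p}} → 0# ≤ y → q / p ≤ b / a →
                   ι p * x ≤ ι q * y → ι a * x ≤ ι b * y
  ι-ratio-weaken p {q} {a} {b} {x} {y} 0≤y (*≤* qa≤bp) px≤qy = ι-*-cancelˡ-≤ p (begin
    ι p * (ι a * x)       ≈⟨ x∙yz≈y∙xz (ι p) (ι a) x ⟩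
    ι a * (ι p * x)       ≤⟨ *-monoˡ-≤-nonNeg (0≤ι a) px≤qy ⟩
    ι a * (ι q * y)       ≈⟨ x∙yz≈y∙xz (ι a) (ι q) y ⟩
    ι q * (ι a * y)       ≈⟨ ι-*-assoc q a y ⟨
    ι (q ℕ.* a) * y       ≤⟨ ι-monoˡ-≤ qa≤bp 0≤y ⟩
    ι (b ℕ.* p) * y       ≈⟨ ι-*-assoc b p y ⟩
    ι b * (ι p * y)       ≈⟨ x∙yz≈y∙xz (ι b) (ι p) y ⟩
    ι p * (ι b * y)       ∎)

  x*[y-y]≈0 : ∀ x y → x * (y - y) ≈ 0#
  x*[y-y]≈0 x y = trans (*-congˡ (-‿inverseʳ y)) (zeroʳ x)

elements : ∀ {n} → Subset n → List (Fin n)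
elements []            = []
elements (inside ∷ p)  = Fin.zero ∷ map Fin.suc (elements p)
elements (outside ∷ p) = map Fin.suc (elements p)

length-elements : ∀ {n} (p : Subset n) → length (elements p) ≡ ∣ p ∣
length-elements []            = ≡.refl
length-elements (inside ∷ p)  =
  ≡.cong suc (≡.trans (length-map Fin.suc (elements p)) (length-elements p))
length-elements (outside ∷ p) = ≡.trans (length-map Fin.suc (elements p)) (length-elements p)

∈-elements⁺ : ∀ {n} {p : Subset n} {x} → x ∈ p → x ∈ₗ elements p
∈-elements⁺ {p = inside ∷ p}  here        = here ≡.refl
∈-elements⁺ {p = inside ∷ p}  (there x∈p) = there (∈-map⁺ Fin.suc (∈-elements⁺ x∈p))
∈-elements⁺ {p = outside ∷ p} (there x∈p) = ∈-map⁺ Fin.suc (∈-elements⁺ x∈p)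

∈-elements⁻ : ∀ {n} (p : Subset n) {x} → x ∈ₗ elements p → x ∈ p
∈-elements⁻ (inside ∷ p) (here ≡.refl) = here
∈-elements⁻ (inside ∷ p) (there x∈) with ∈-map⁻ Fin.suc x∈
... | _ , y∈ , ≡.refl = there (∈-elements⁻ p y∈)
∈-elements⁻ (outside ∷ p) x∈ with ∈-map⁻ Fin.suc x∈
... | _ , y∈ , ≡.refl = there (∈-elements⁻ p y∈)

∪⁅⁆⊆ : ∀ {n} {p : Subset n} {y} → y ∈ p → p ∪ ⁅ y ⁆ ⊆ p
∪⁅⁆⊆ {p = p} {y} y∈p x∈ with x∈p∪q⁻ p ⁅ y ⁆ x∈
... | inj₁ x∈p  = x∈p
... | inj₂ x∈⁅y⁆ = ≡.subst (_∈ p) (≡.sym (x∈⁅y⁆⇒x≡y y x∈⁅y⁆)) y∈p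

module _ {n N} (block : Fin n → Fin N) where
  open Partition block

  ∈-blockSet⁻ : ∀ {y j} → y ∈ blockSet j → block y ≡ j
  ∈-blockSet⁻ {y} y∈ =
    toWitness (Equivalence.from T-≡ (≡.trans (≡.sym (lookup∘tabulate _ y)) ([]=⇒lookup y∈)))

  ∈-blockSet⁺ : ∀ y → y ∈ blockSet (block y)
  ∈-blockSet⁺ y =
    lookup⇒[]= y _ (≡.trans (lookup∘tabulate _ y) (Equivalence.to T-≡ (fromWitness ≡.refl)))

module SubmodularGain {a ℓ₁ ℓ₂} (R : OrderedCommRing a ℓ₁ ℓ₂) {n : ℕ}
  (f : Subset n → OrderedCommRing.Carrier R)
  (mono : SetFunctions.Monotone R f) (submod : SetFunctions.Submodular R f) where

  open OrderedCommRing R hiding (+-mono-≤)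
  open OrderedCommRingProperties R
  open SetFunctions R {n} using (Δ)
  open ≤-Reasoning

  Δ-antitone : ∀ {A B} → A ⊆ B → ∀ y → Δ f B y ≤ Δ f A y
  Δ-antitone {A} {B} A⊆B y with y ∈? B
  ... | no  y∉B = submod A B y A⊆B y∉B
  ... | yes y∈B = begin
    f (B ∪ ⁅ y ⁆) - f B   ≤⟨ +-monoˡ-≤ (- f B) (mono _ _ (∪⁅⁆⊆ y∈B)) ⟩
    f B - f B             ≈⟨ -‿inverseʳ (f B) ⟩
    0#                    ≤⟨ x≤y⇒0≤y-x (mono A (A ∪ ⁅ y ⁆) (p⊆p∪q ⁅ y ⁆)) ⟩
    f (A ∪ ⁅ y ⁆) - f A   ∎

  ΣΔ : Subset n → List (Fin n) → Carrier
  ΣΔ S = foldr (λ y g → Δ f S y + g) 0#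

  ΣΔ-++ : ∀ S xs ys → ΣΔ S (xs ++ ys) ≈ ΣΔ S xs + ΣΔ S ys
  ΣΔ-++ S []       ys = sym (+-identityˡ (ΣΔ S ys))
  ΣΔ-++ S (x ∷ xs) ys = trans (+-congˡ (ΣΔ-++ S xs ys)) (sym (+-assoc (Δ f S x) (ΣΔ S xs) (ΣΔ S ys)))

  ΣΔ-≤-length : ∀ {z d S} ys → (∀ {y} → y ∈ₗ ys → z * Δ f S y ≤ d) → z * ΣΔ S ys ≤ ι (length ys) * d
  ΣΔ-≤-length {z} {d} []       _     = ≤-reflexive (trans (zeroʳ z) (sym (zeroˡ d)))
  ΣΔ-≤-length {z} {d} {S} (y ∷ ys) bound = begin
    z * (Δ f S y + ΣΔ S ys)    ≈⟨ distribˡ z (Δ f S y) (ΣΔ S ys) ⟩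
    z * Δ f S y + z * ΣΔ S ys  ≤⟨ +-mono-≤ (bound (here ≡.refl)) (ΣΔ-≤-length ys (bound ∘ there)) ⟩
    d + ι (length ys) * d      ≈⟨ ι-suc-* (length ys) d ⟨
    ι (length (y ∷ ys)) * d    ∎

  _∪ₗ_ : Subset n → List (Fin n) → Subset n
  S ∪ₗ ys = foldr (λ y T → T ∪ ⁅ y ⁆) S ys

  ⊆-∪ₗ : ∀ S ys → S ⊆ S ∪ₗ ys
  ⊆-∪ₗ S []       = ⊆-refl
  ⊆-∪ₗ S (y ∷ ys) = ⊆-trans (⊆-∪ₗ S ys) (p⊆p∪q ⁅ y ⁆)

  ∈-∪ₗ : ∀ S {ys y} → y ∈ₗ ys → y ∈ S ∪ₗ ys
  ∈-∪ₗ S {y ∷ ys} (here ≡.refl) = x∈p∪q⁺ (inj₂ (x∈⁅x⁆ y))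
  ∈-∪ₗ S {y ∷ ys} (there y∈)    = p⊆p∪q ⁅ y ⁆ (∈-∪ₗ S y∈)

  ∪ₗ-gain≤ΣΔ : ∀ S ys → f (S ∪ₗ ys) - f S ≤ ΣΔ S ys
  ∪ₗ-gain≤ΣΔ S []       = ≤-reflexive (-‿inverseʳ (f S))
  ∪ₗ-gain≤ΣΔ S (y ∷ ys) = begin
    f (B ∪ ⁅ y ⁆) - f S       ≈⟨ [y-x]+[z-y]≈z-x (f S) (f B) (f (B ∪ ⁅ y ⁆)) ⟨
    (f B - f S) + Δ f B y     ≤⟨ +-mono-≤ (∪ₗ-gain≤ΣΔ S ys) (Δ-antitone (⊆-∪ₗ S ys) y) ⟩
    ΣΔ S ys + Δ f S y         ≈⟨ +-comm (ΣΔ S ys) (Δ f S y) ⟩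
    Δ f S y + ΣΔ S ys         ∎
    where B = S ∪ₗ ys

module BlockGreedy {a ℓ₁ ℓ₂} (R : OrderedCommRing a ℓ₁ ℓ₂) {n N : ℕ} (block : Fin n → Fin N)
  (f : Subset n → OrderedCommRing.Carrier R)
  (mono : SetFunctions.Monotone R f) (submod : SetFunctions.Submodular R f) where

  open OrderedCommRing R hiding (+-mono-≤)
  open OrderedCommRingProperties R
  open SetFunctions R {n} using (Δ)
  open SubmodularGain R f mono submod
  open Greedy R block f
  open Partition block
  open import Algebra.Properties.CommutativeSemigroup *-commutativeSemigroup using (x∙yz≈y∙xz)
  open ≤-Reasoning

  Run-⊆ : ∀ {js S T} → Run js S T → S ⊆ T
  Run-⊆ done             = ⊆-refl
  Run-⊆ (step x _ _ run) = ⊆-trans (p⊆p∪q ⁅ x ⁆) (Run-⊆ run)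

  Run-++⁻ : ∀ xs {ys S T} → Run (xs ++ ys) S T → ∃[ M ] Run xs S M × Run ys M T
  Run-++⁻ []       run = _ , done , run
  Run-++⁻ (j ∷ xs) (step x x∈Uj greedy run) with Run-++⁻ xs run
  ... | M , run₁ , run₂ = M , step x x∈Uj greedy run₁ , run₂

  greedy-steps-Δ≤ : ∀ r {j A M S' y} → Run (replicate r j) A M → M ⊆ S' → block y ≡ j →
                    ι r * Δ f S' y ≤ f M - f A
  greedy-steps-Δ≤ zero {A = A} {S' = S'} {y} done _ _ = begin
    0# * Δ f S' y   ≈⟨ zeroˡ (Δ f S' y) ⟩
    0#              ≈⟨ -‿inverseʳ (f A) ⟨
    f A - f A       ∎
  greedy-steps-Δ≤ (suc r) {A = A} {M} {S'} {y} (step x x∈Uj greedy run) M⊆S' y∈Uj = begin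
    ι (suc r) * Δ f S' y                 ≈⟨ ι-suc-* r (Δ f S' y) ⟩
    Δ f S' y + ι r * Δ f S' y            ≤⟨ +-mono-≤ (≤-trans (Δ-antitone A⊆S' y) (greedy y y∈Uj))
                                                     (greedy-steps-Δ≤ r run M⊆S' y∈Uj) ⟩
    Δ f A x + (f M - f (A ∪ ⁅ x ⁆))      ≈⟨ [y-x]+[z-y]≈z-x (f A) (f (A ∪ ⁅ x ⁆)) (f M) ⟩
    f M - f A                            ∎
    where A⊆S' = ⊆-trans (Run-⊆ (step x x∈Uj greedy run)) M⊆S'

  greedy-block-ΣΔ≤ : ∀ c r {j A M S'} ys → Run (replicate r j) A M → M ⊆ S' →
                     (∀ {y} → y ∈ₗ ys → block y ≡ j) → length ys ℕ.≤ c ℕ.* r →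
                     ΣΔ S' ys ≤ ι c * (f M - f A)
  greedy-block-ΣΔ≤ c zero {A = A} [] done _ _ _ = ≤-reflexive (sym (x*[y-y]≈0 (ι c) (f A)))
  greedy-block-ΣΔ≤ c zero (_ ∷ _) done _ _ len≤ with ℕ.≤-trans len≤ (ℕ.≤-reflexive (ℕ.*-zeroʳ c))
  ... | ()
  greedy-block-ΣΔ≤ c (suc r) {A = A} {M} {S'} ys run M⊆S' ys⊆Uj len≤ = ι-*-cancelˡ-≤ (suc r) (begin
    ι (suc r) * ΣΔ S' ys
      ≤⟨ ΣΔ-≤-length ys (λ y∈ → greedy-steps-Δ≤ (suc r) run M⊆S' (ys⊆Uj y∈)) ⟩
    ι (length ys) * (f M - f A)         ≤⟨ ι-monoˡ-≤ len≤ (x≤y⇒0≤y-x (mono A M (Run-⊆ run))) ⟩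
    ι (c ℕ.* suc r) * (f M - f A)       ≈⟨ ι-*-assoc c (suc r) (f M - f A) ⟩
    ι c * (ι (suc r) * (f M - f A))     ≈⟨ x∙yz≈y∙xz (ι c) (ι (suc r)) (f M - f A) ⟩
    ι (suc r) * (ι c * (f M - f A))     ∎)

  module Rounds (c : ℕ) (r : Fin N → ℕ) (OPT : Subset n)
                (capacity : ∀ j → ∣ OPT ∩ blockSet j ∣ ℕ.≤ c ℕ.* r j) where

    blockRun : Fin N → List (Fin N)
    blockRun j = replicate (r j) j

    round : List (Fin N)
    round = concatMap blockRun (allFin N)

    OPTin : Fin N → List (Fin n)
    OPTin j = elements (OPT ∩ blockSet j)

    greedy-blocks-ΣΔ≤ : ∀ js {S T S'} → Run (concatMap blockRun js) S T → T ⊆ S' →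
                        ΣΔ S' (concatMap OPTin js) ≤ ι c * (f T - f S)
    greedy-blocks-ΣΔ≤ [] {S} done _ = ≤-reflexive (sym (x*[y-y]≈0 (ι c) (f S)))
    greedy-blocks-ΣΔ≤ (j ∷ js) {S} {T} {S'} run T⊆S' with Run-++⁻ (blockRun j) run
    ... | M , run₁ , run₂ = begin
      ΣΔ S' (OPTin j ++ concatMap OPTin js)           ≈⟨ ΣΔ-++ S' (OPTin j) (concatMap OPTin js) ⟩
      ΣΔ S' (OPTin j) + ΣΔ S' (concatMap OPTin js)    ≤⟨ +-mono-≤ block-j (greedy-blocks-ΣΔ≤ js run₂ T⊆S') ⟩
      ι c * (f M - f S) + ι c * (f T - f M)           ≈⟨ distribˡ (ι c) (f M - f S) (f T - f M) ⟨
      ι c * ((f M - f S) + (f T - f M))               ≈⟨ *-congˡ ([y-x]+[z-y]≈z-x (f S) (f M) (f T)) ⟩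
      ι c * (f T - f S)                               ∎
      where
      block-j : ΣΔ S' (OPTin j) ≤ ι c * (f M - f S)
      block-j = greedy-block-ΣΔ≤ c (r j) (OPTin j) run₁ (⊆-trans (Run-⊆ run₂) T⊆S')
        (λ y∈ → ∈-blockSet⁻ block (proj₂ (x∈p∩q⁻ OPT (blockSet j) (∈-elements⁻ _ y∈))))
        (≡.subst (ℕ._≤ c ℕ.* r j) (≡.sym (length-elements (OPT ∩ blockSet j))) (capacity j))

    OPT⊆∪ₗ : ∀ S → OPT ⊆ S ∪ₗ concatMap OPTin (allFin N)
    OPT⊆∪ₗ S {y} y∈OPT = ∈-∪ₗ S (∈-concatMap⁺ OPTin (lose (∈-allFin (block y)) y∈OPTin))
      where
      y∈OPTin : y ∈ₗ OPTin (block y)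
      y∈OPTin = ∈-elements⁺ (x∈p∩q⁺ (y∈OPT , ∈-blockSet⁺ block y))

    round-progress : ∀ {S T} → Run round S T → ι (suc c) * (f OPT - f T) ≤ ι c * (f OPT - f S)
    round-progress {S} {T} run = begin
      ι (suc c) * (F - f T)                   ≈⟨ ι-suc-* c (F - f T) ⟩
      (F - f T) + ι c * (F - f T)             ≤⟨ +-monoˡ-≤ (ι c * (F - f T)) gap ⟩
      ι c * (f T - f S) + ι c * (F - f T)     ≈⟨ distribˡ (ι c) (f T - f S) (F - f T) ⟨
      ι c * ((f T - f S) + (F - f T))         ≈⟨ *-congˡ ([y-x]+[z-y]≈z-x (f S) (f T) F) ⟩
      ι c * (F - f S)                         ∎
      where
      F = f OPT
      ys = concatMap OPTin (allFin N)
      gap : F - f T ≤ ι c * (f T - f S)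
      gap = begin
        F - f T             ≤⟨ +-monoˡ-≤ (- f T) (mono OPT (T ∪ₗ ys) (OPT⊆∪ₗ T)) ⟩
        f (T ∪ₗ ys) - f T   ≤⟨ ∪ₗ-gain≤ΣΔ T ys ⟩
        ΣΔ T ys             ≤⟨ greedy-blocks-ΣΔ≤ (allFin N) run ⊆-refl ⟩
        ι c * (f T - f S)   ∎

    rounds-progress : ∀ t {S T} → Run (concat (replicate t round)) S T →
                      ι (suc c ℕ.^ t) * (f OPT - f T) ≤ ι (c ℕ.^ t) * (f OPT - f S)
    rounds-progress zero    done = ≤-refl
    rounds-progress (suc t) {S} {T} run with Run-++⁻ round run
    ... | M , run₁ , run₂ = begin
      ι (suc c ℕ.^ suc t) * (F - f T)            ≈⟨ ι-*-assoc (suc c) (suc c ℕ.^ t) (F - f T) ⟩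
      ι (suc c) * (ι (suc c ℕ.^ t) * (F - f T))  ≤⟨ *-monoˡ-≤-nonNeg (0≤ι (suc c)) (rounds-progress t run₂) ⟩
      ι (suc c) * (ι cᵗ * (F - f M))             ≈⟨ x∙yz≈y∙xz (ι (suc c)) (ι cᵗ) (F - f M) ⟩
      ι cᵗ * (ι (suc c) * (F - f M))             ≤⟨ *-monoˡ-≤-nonNeg (0≤ι cᵗ) (round-progress run₁) ⟩
      ι cᵗ * (ι c * (F - f S))                   ≈⟨ x∙yz≈y∙xz (ι cᵗ) (ι c) (F - f S) ⟩
      ι c * (ι cᵗ * (F - f S))                   ≈⟨ ι-*-assoc c cᵗ (F - f S) ⟨
      ι (c ℕ.^ suc t) * (F - f S)                ∎
      where
      F = f OPT
      cᵗ = c ℕ.^ t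

    schedule-ratio : 0# ≤ f ⊥ → ∀ {S} → Run (schedule c r) ⊥ S →
                     ι (suc c ℕ.^ c) * (f OPT - f S) ≤ ι (c ℕ.^ c) * f OPT
    schedule-ratio 0≤f⊥ run =
      ≤-trans (rounds-progress c run) (*-monoˡ-≤-nonNeg (0≤ι (c ℕ.^ c)) (0≤y⇒x-y≤x 0≤f⊥))

module _ {a ℓ₁ ℓ₂} (R : OrderedCommRing a ℓ₁ ℓ₂) where
  open OrderedCommRing R hiding (+-mono-≤)
  open OrderedCommRingProperties R
  open import Algebra.Properties.Ring ring using (x[y-z]≈xy-xz)
  open ≤-Reasoning

  ApproxBound-from-ratio : ∀ c m {s F} → 0# ≤ F →
                           ι (suc c ℕ.^ c) * (F - s) ≤ ι (c ℕ.^ c) * F → ApproxBound R c m s F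
  ApproxBound-from-ratio c m {s} {F} 0≤F ratio = x-y≤z⇒x≤y+z (begin
    ι A * F - ι A * s   ≈⟨ x[y-z]≈xy-xz (ι A) F s ⟨
    ι A * (F - s)       ≤⟨ ι-ratio-weaken (suc c ℕ.^ c) {{ℕ.m^n≢0 (suc c) c}} 0≤F (ratio-bound c m) ratio ⟩
    ι B * F             ∎)
    where
    A = c ℕ.* suc m ℕ.^ m
    B = c ℕ.* m ℕ.^ m ℕ.+ suc m ℕ.^ m

open import Data.Nat using (ℕ; _*_; _<_; _≤_)

theorem9 : ∀ {a ℓ₁ ℓ₂} (R : OrderedCommRing a ℓ₁ ℓ₂) →
    (n N : ℕ) (block : Fin n → Fin N) (f : Subset n → OrderedCommRing.Carrier R) →
    SetFunctions.NonNegative R f → SetFunctions.Monotone R f → SetFunctions.Submodular R f →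
    0 < N →
    (k : Fin N → ℕ) → (∀ j → 1 ≤ k j) → (∀ j → k j ≤ ∣ Partition.blockSet block j ∣) →
    (c : ℕ) → c ≡ gcdAll k →
    (r : Fin N → ℕ) → (∀ j → k j ≡ c * r j) →
    (OPT : Subset n) → Partition.InP block k OPT →
    (∀ T → Partition.InP block k T → OrderedCommRing._≤_ R (f T) (f OPT)) →
    (S : Subset n) → Greedy.Run R block f (schedule c r) ⊥ S →
    (m : ℕ) → ApproxBound R c m (f S) (f OPT)
theorem9 R _ _ block f f≥0 mono submod _ _ _ _ c _ r k≡cr OPT OPT∈𝒫 _ _ run m =
  ApproxBound-from-ratio R c m (f≥0 OPT) (schedule-ratio (f≥0 ⊥) run)
  where
  open Partition block
  open BlockGreedy R block f mono submod

  capacity : ∀ j → ∣ OPT ∩ blockSet j ∣ ≤ c * r j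
  capacity j = ≡.subst (∣ OPT ∩ blockSet j ∣ ≤_) (k≡cr j) (OPT∈𝒫 j)

  open Rounds c r OPT capacity
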